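{- Let $h\ge 2$ and $w=2h$ (an even number of digits). Let $m,n\in A_w$ with $p(m)=(\alpha^1,\alpha^2,\dots,\alpha^h)$ where $\alpha^1\ge\alpha^2+1$, and $p(n)=(10-\alpha^h,\ 9-\alpha^{h-1},\ 9-\alpha^{h-2},\ \dots,\ 9-\alpha^2,\ 10-\alpha^1)$ (first entry $10-\alpha^h$, $s$-th entry $9-\alpha^{h-s+1}$ for $2\le s\le h-1$, last entry $10-\alpha^1$). Then $K^2(m)=K^2(n)$.
   Context: A $w$-digit number is a string of $w$ decimal digits (leading zeros allowed); $A_w$ is the set of those whose digits are not all identical. For a $w$-digit number $n$, $O_d(n)=x_1\dots x_w$ is obtained by sorting its digits in non-increasing order and $O_u(n)=x_w\dots x_1$ by sorting them in non-decreasing order; the Kaprekar map is $K(n)=O_d(n)-O_u(n)$, written as a $w$-digit string with leading zeros, and $K^2=K\circ K$. With $h=\lfloor w/2\rfloor$, the parameters of a $w$-digit number $n$ are $p(n)=(\alpha^1,\dots,\alpha^h)$, $\alpha^s=x_s-x_{w-s+1}$ where $x_1\ge\dots\ge x_w$ are its sorted digits. -}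

module Defs where

open import Data.Nat using (ℕ; zero; suc; _+_; _∸_; _*_; _^_; _≤ᵇ_; _≡ᵇ_)
open import Data.Nat.DivMod using (_/_; _mod_)
open import Data.Fin using (Fin; toℕ; fromℕ; opposite)
open import Data.Vec using (Vec; []; _∷_; lookup; tabulate; map; reverse; foldl)
open import Data.Bool using (Bool; true; false; if_then_else_; _∨_)
open import Data.Product using (∃₂)
open import Relation.Binary.PropositionalEquality using (_≢_)

-- A w-digit number: a vector of w decimal digits, most significant first.
Number : ℕ → Set
Number w = Vec (Fin 10) w

InA : ∀ {w} → Number w → Set
InA {w} n = ∃₂ λ (i j : Fin w) → lookup n i ≢ lookup n j

value : ∀ {w} → Vec ℕ w → ℕ
value = foldl _ (λ acc d → acc * 10 + d) 0

-- w-digit representation (with leading zeros) of x mod 10^w, big-endian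
toDigitsLE : (w : ℕ) → ℕ → Vec (Fin 10) w
toDigitsLE zero    x = []
toDigitsLE (suc w) x = (x mod 10) ∷ toDigitsLE w (x / 10)

toDigits : (w : ℕ) → ℕ → Number w
toDigits w x = reverse (toDigitsLE w x)

insertDesc : ∀ {k} → ℕ → Vec ℕ k → Vec ℕ (suc k)
insertDesc x [] = x ∷ []
insertDesc x (y ∷ ys) = if y ≤ᵇ x then x ∷ y ∷ ys else y ∷ insertDesc x ys

sortDesc : ∀ {k} → Vec ℕ k → Vec ℕ k
sortDesc [] = []
sortDesc (x ∷ xs) = insertDesc x (sortDesc xs)

Od : ∀ {w} → Number w → Vec ℕ w
Od n = sortDesc (map toℕ n)

Ou : ∀ {w} → Number w → Vec ℕ w
Ou n = reverse (Od n)

K : ∀ {w} → Number w → Number w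
K {w} n = toDigits w (value (Od n) ∸ value (Ou n))

K² : ∀ {w} → Number w → Number w
K² n = K (K n)

-- parameters of an even-length number (w = h + h, so ⌊w/2⌋ = h):
-- α^s = x_s − x_{w−s+1}, stored 0-indexed: entry i is α^{i+1}.
params : ∀ h → Number (h + h) → Vec ℕ h
params h n = tabulate λ (i : Fin h) →
  lookup (Od n) (Data.Fin._↑ˡ_ i h) ∸ lookup (Od n) (opposite (Data.Fin._↑ˡ_ i h))

-- the "complementary" parameter vector
-- (10 − α^h, 9 − α^{h−1}, …, 9 − α^2, 10 − α^1):
-- 0-indexed entry i is c_i − α^{h−i} with c_i = 10 at the two ends, 9 otherwise.
isEnd : ∀ {h} → Fin h → Bool
isEnd {h} i = (toℕ i ≡ᵇ 0) ∨ (toℕ i ≡ᵇ (h ∸ 1))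

complParams : ∀ {h} → Vec ℕ h → Vec ℕ h
complParams {h} α = tabulate λ i → (if isEnd i then 10 else 9) ∸ lookup α (opposite i)

-- Write α = (a, mid, b) for the parameters of m. The sorted digits of m split into halves L and R
-- with L = α + reverse R, so O_d(m) − O_u(m) = value α · 10^h − value (reverse α).  For b ≥ 1 this
-- subtraction borrows exactly once, and the digits of K(m) are  a, mid, b − 1  followed by
-- 9 − b, 9 − reverse mid, 10 − a.  For the complementary parameters (10 − b, 9 − reverse mid, 10 − a)
-- each of these two blocks of K(n) is the reversed nines' complement of the corresponding block of K(m),
-- so K(n) is a digit permutation of 9 − K(m) and O_d(K n) = 9 − O_u(K m).  Finally, complementing
-- every digit swaps and complements O_d and O_u, which leaves O_d − O_u unchanged.
module Submission where

open import Defs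
open import Data.Bool using (true; false; if_then_else_)
open import Data.Empty using (⊥-elim)
open import Data.Fin using (Fin; zero; suc; toℕ; opposite; fromℕ; inject₁; _↑ˡ_; _↑ʳ_)
open import Data.Fin.Properties using (toℕ-fromℕ<; toℕ<n; toℕ-injective; toℕ-↑ˡ; toℕ-↑ʳ; opposite-prop; opposite-involutive)
import Data.List as List
open import Data.List.Relation.Binary.Permutation.Propositional using (_↭_; prep; swap; ↭-refl; ↭-trans; ↭-sym; ↭⇒↭ₛ)
open import Data.List.Relation.Binary.Permutation.Propositional.Properties using (↭-reverse; ++⁺; map⁺; All-resp-↭)
open import Data.List.Relation.Binary.Pointwise using () renaming (Pointwise-≡⇒≡ to List-Pointwise-≡⇒≡)
open import Data.List.Relation.Unary.Linked using ([]; [-]; _∷_)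
open import Data.List.Relation.Unary.Sorted.TotalOrder using (Sorted)
open import Data.List.Relation.Unary.Sorted.TotalOrder.Properties using (↗↭↗⇒≋)
open import Data.Nat using (ℕ; zero; suc; _+_; _*_; _∸_; _^_; _≤_; _<_; _≥_; z≤n; s≤s; _≤ᵇ_; _≡ᵇ_)
open import Data.Nat.Divisibility using (n∣m*n)
open import Data.Nat.DivMod using (_/_; _%_; m%n<n; %-remove-+ˡ; m<n⇒m%n≡m; +-distrib-/-∣ˡ; m*n/n≡m; m<n⇒m/n≡0)
open import Data.Nat.Properties
open import Data.Nat.Tactic.RingSolver using (solve-∀)
open import Data.Product using (_×_; _,_; proj₁; proj₂)
open import Data.Vec using (Vec; []; _∷_; lookup; map; reverse; _∷ʳ_; _++_; zipWith; tabulate; toList; foldl; splitAt; initLast)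
open import Data.Vec.Properties
  using (lookup-map; lookup-zipWith; tabulate-cong; lookup-++ˡ; lookup-++ʳ; lookup∘tabulate; toList-injective; toList-map; toList-reverse; toList-++;
         reverse-∷; reverse-involutive; reverse-++-eqFree; cast-is-id; map-reverse; map-∷ʳ; map-++; foldl-∷ʳ)
open import Data.Vec.Relation.Binary.Pointwise.Extensional using (ext; Pointwise-≡⇒≡)
open import Data.Vec.Relation.Unary.All as All using (All; []; _∷_)
import Data.Vec.Relation.Unary.All.Properties as All
open import Data.Vec.Relation.Unary.Linked using (Linked; []; [-]; _∷_)
import Data.Vec.Relation.Unary.Linked.Properties as Linked
open import Relation.Binary.Construct.Flip.EqAndOrd using () renaming (totalOrder to flipTotalOrder)
open import Relation.Binary.PropositionalEquality using (_≡_; refl; sym; trans; cong; cong₂; subst; subst₂; module ≡-Reasoning)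
open import Relation.Nullary.Reflects using (ofʸ; ofⁿ)
open ≡-Reasoning

private
  variable
    A : Set
    k n : ℕ

lookup-∷ʳ-fromℕ : ∀ (xs : Vec A n) x → lookup (xs ∷ʳ x) (fromℕ n) ≡ x
lookup-∷ʳ-fromℕ []       x = refl
lookup-∷ʳ-fromℕ (_ ∷ xs) x = lookup-∷ʳ-fromℕ xs x

lookup-∷ʳ-inject₁ : ∀ (xs : Vec A n) x i → lookup (xs ∷ʳ x) (inject₁ i) ≡ lookup xs i
lookup-∷ʳ-inject₁ (_ ∷ xs) x zero    = refl
lookup-∷ʳ-inject₁ (_ ∷ xs) x (suc i) = lookup-∷ʳ-inject₁ xs x i

lookup-reverse-opposite : ∀ (xs : Vec A n) i → lookup (reverse xs) (opposite i) ≡ lookup xs i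
lookup-reverse-opposite (x ∷ xs) i rewrite reverse-∷ x xs with i
... | zero  = lookup-∷ʳ-fromℕ (reverse xs) x
... | suc j = trans (lookup-∷ʳ-inject₁ (reverse xs) x (opposite j)) (lookup-reverse-opposite xs j)

lookup-reverse : ∀ (xs : Vec A n) i → lookup (reverse xs) i ≡ lookup xs (opposite i)
lookup-reverse xs i = begin
  lookup (reverse xs) i                      ≡⟨ cong (lookup (reverse xs)) (sym (opposite-involutive i)) ⟩
  lookup (reverse xs) (opposite (opposite i)) ≡⟨ lookup-reverse-opposite xs (opposite i) ⟩
  lookup xs (opposite i)                     ∎

reverse-∷ʳ : ∀ (xs : Vec A n) y → reverse (xs ∷ʳ y) ≡ y ∷ reverse xs
reverse-∷ʳ []       y = refl
reverse-∷ʳ (x ∷ xs) y = begin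
  reverse (x ∷ (xs ∷ʳ y))  ≡⟨ reverse-∷ x (xs ∷ʳ y) ⟩
  reverse (xs ∷ʳ y) ∷ʳ x   ≡⟨ cong (_∷ʳ x) (reverse-∷ʳ xs y) ⟩
  y ∷ (reverse xs ∷ʳ x)    ≡⟨ cong (y ∷_) (sym (reverse-∷ x xs)) ⟩
  y ∷ reverse (x ∷ xs)     ∎

reverse-∷-∷ʳ : ∀ x (xs : Vec A n) y → reverse (x ∷ (xs ∷ʳ y)) ≡ y ∷ (reverse xs ∷ʳ x)
reverse-∷-∷ʳ x xs y = trans (reverse-∷ x (xs ∷ʳ y)) (cong (_∷ʳ x) (reverse-∷ʳ xs y))

reverse-zipWith : ∀ (f : A → A → A) (xs ys : Vec A n) →
                  reverse (zipWith f xs ys) ≡ zipWith f (reverse xs) (reverse ys)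
reverse-zipWith f xs ys = Pointwise-≡⇒≡ (ext λ i → begin
  lookup (reverse (zipWith f xs ys)) i                    ≡⟨ lookup-reverse (zipWith f xs ys) i ⟩
  lookup (zipWith f xs ys) (opposite i)                   ≡⟨ lookup-zipWith f (opposite i) xs ys ⟩
  f (lookup xs (opposite i)) (lookup ys (opposite i))     ≡⟨ sym (cong₂ f (lookup-reverse xs i) (lookup-reverse ys i)) ⟩
  f (lookup (reverse xs) i) (lookup (reverse ys) i)       ≡⟨ sym (lookup-zipWith f i (reverse xs) (reverse ys)) ⟩
  lookup (zipWith f (reverse xs) (reverse ys)) i          ∎)

module _ {P : ℕ → Set} where

  All-reverse⁺ : ∀ {xs : Vec ℕ n} → All P xs → All P (reverse xs)
  All-reverse⁺ {xs = xs} ps = All.lookup⁻ λ i → subst P (sym (lookup-reverse xs i)) (All.lookup⁺ ps (opposite i))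

  All-∷ʳ⁺ : ∀ {xs : Vec ℕ n} {y} → All P xs → P y → All P (xs ∷ʳ y)
  All-∷ʳ⁺ []       py = py ∷ []
  All-∷ʳ⁺ (p ∷ ps) py = p ∷ All-∷ʳ⁺ ps py

  All-∷ʳ⁻ : ∀ (xs : Vec ℕ n) {y} → All P (xs ∷ʳ y) → All P xs × P y
  All-∷ʳ⁻ []       (py ∷ []) = [] , py
  All-∷ʳ⁻ (_ ∷ xs) (p ∷ ps) with All-∷ʳ⁻ xs ps
  ... | ps′ , py = p ∷ ps′ , py

-- Sorting

Descending : Vec ℕ n → Set
Descending = Linked _≥_

_↭ᵛ_ : Vec ℕ n → Vec ℕ n → Set
xs ↭ᵛ ys = toList xs ↭ toList ys

insertDesc-below : ∀ {z} x (ys : Vec ℕ n) → x ≤ z → Descending (z ∷ ys) → Descending (z ∷ insertDesc x ys)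
insertDesc-below x []       x≤z _          = x≤z ∷ [-]
insertDesc-below x (y ∷ ys) x≤z (y≤z ∷ ds) with y ≤ᵇ x | ≤ᵇ-reflects-≤ y x
... | true  | ofʸ y≤x = x≤z ∷ y≤x ∷ ds
... | false | ofⁿ y≰x = y≤z ∷ insertDesc-below x ys (≰⇒≥ y≰x) ds

insertDesc-descending : ∀ x (ys : Vec ℕ n) → Descending ys → Descending (insertDesc x ys)
insertDesc-descending x []       _  = [-]
insertDesc-descending x (y ∷ ys) ds with y ≤ᵇ x | ≤ᵇ-reflects-≤ y x
... | true  | ofʸ y≤x = y≤x ∷ ds
... | false | ofⁿ y≰x = insertDesc-below x ys (≰⇒≥ y≰x) ds

sortDesc-descending : ∀ (xs : Vec ℕ n) → Descending (sortDesc xs)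
sortDesc-descending []       = []
sortDesc-descending (x ∷ xs) = insertDesc-descending x (sortDesc xs) (sortDesc-descending xs)

insertDesc-↭ : ∀ x (ys : Vec ℕ n) → insertDesc x ys ↭ᵛ (x ∷ ys)
insertDesc-↭ x []       = ↭-refl
insertDesc-↭ x (y ∷ ys) with y ≤ᵇ x
... | true  = ↭-refl
... | false = ↭-trans (prep y (insertDesc-↭ x ys)) (swap y x ↭-refl)

sortDesc-↭ : ∀ (xs : Vec ℕ n) → sortDesc xs ↭ᵛ xs
sortDesc-↭ []       = ↭-refl
sortDesc-↭ (x ∷ xs) = ↭-trans (insertDesc-↭ x (sortDesc xs)) (prep x (sortDesc-↭ xs))

descending-lookup⁺ : ∀ {xs : Vec ℕ n} {i j : Fin n} → Descending xs → toℕ i < toℕ j → lookup xs j ≤ lookup xs i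
descending-lookup⁺ = Linked.lookup⁺ (λ p q → ≤-trans q p)

descending-lookup⁻ : ∀ {xs : Vec ℕ n} → (∀ {i j : Fin n} → toℕ i < toℕ j → lookup xs j ≤ lookup xs i) → Descending xs
descending-lookup⁻ {xs = []}         _    = []
descending-lookup⁻ {xs = _ ∷ []}     _    = [-]
descending-lookup⁻ {xs = _ ∷ _ ∷ _} mono =
  mono {zero} {suc zero} (s≤s z≤n) ∷ descending-lookup⁻ (λ i<j → mono (s≤s i<j))

descending⇒sorted : ∀ {xs : Vec ℕ n} → Descending xs → Sorted (flipTotalOrder ≤-totalOrder) (toList xs)
descending⇒sorted []                     = []
descending⇒sorted [-]                    = [-]
descending⇒sorted {xs = _ ∷ _ ∷ _} (p ∷ ds) = p ∷ descending⇒sorted ds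

descending-↭⇒≡ : ∀ {xs ys : Vec ℕ n} → Descending xs → Descending ys → xs ↭ᵛ ys → xs ≡ ys
descending-↭⇒≡ {xs = xs} {ys} dxs dys xs↭ys =
  trans (sym (cast-is-id refl xs))
        (toList-injective refl xs ys (List-Pointwise-≡⇒≡
          (↗↭↗⇒≋ (flipTotalOrder ≤-totalOrder) (descending⇒sorted dxs) (descending⇒sorted dys) (↭⇒↭ₛ xs↭ys))))

sortDesc-cong-↭ : ∀ {xs ys : Vec ℕ n} → xs ↭ᵛ ys → sortDesc xs ≡ sortDesc ys
sortDesc-cong-↭ {xs = xs} {ys} xs↭ys = descending-↭⇒≡ (sortDesc-descending xs) (sortDesc-descending ys)
  (↭-trans (sortDesc-↭ xs) (↭-trans xs↭ys (↭-sym (sortDesc-↭ ys))))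

sortDesc-All : ∀ {P : ℕ → Set} {xs : Vec ℕ n} → All P xs → All P (sortDesc xs)
sortDesc-All {xs = xs} ps = All.toList⁻ (All-resp-↭ (↭-sym (sortDesc-↭ xs)) (All.toList⁺ ps))

-- Nines' complement

complement : ℕ → ℕ
complement d = 9 ∸ d

complement-involutive : ∀ {d} → d ≤ 9 → complement (complement d) ≡ d
complement-involutive = m∸[m∸n]≡n

complement-≤9 : ∀ d → complement d ≤ 9
complement-≤9 d = m∸n≤m 9 d

map-complement-≤9 : ∀ (xs : Vec ℕ n) → All (_≤ 9) (map complement xs)
map-complement-≤9 xs = All.map⁺ (All.universal complement-≤9 xs)

map-complement-involutive : ∀ {xs : Vec ℕ n} → All (_≤ 9) xs → map complement (map complement xs) ≡ xs
map-complement-involutive []         = refl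
map-complement-involutive (d≤9 ∷ ps) = cong₂ _∷_ (complement-involutive d≤9) (map-complement-involutive ps)

opposite-anti-< : ∀ {i j : Fin n} → toℕ i < toℕ j → toℕ (opposite j) < toℕ (opposite i)
opposite-anti-< {n} {i} {j} i<j =
  subst₂ _<_ (sym (opposite-prop j)) (sym (opposite-prop i)) (∸-monoʳ-< (s≤s i<j) (toℕ<n j))

descending-reverse-complement : ∀ {xs : Vec ℕ n} → Descending xs → Descending (map complement (reverse xs))
descending-reverse-complement {xs = xs} dxs = descending-lookup⁻ λ {i} {j} i<j →
  subst₂ _≤_ (sym (entry j)) (sym (entry i))
    (∸-monoʳ-≤ 9 (descending-lookup⁺ dxs (opposite-anti-< i<j)))
  where
  entry : ∀ i → lookup (map complement (reverse xs)) i ≡ complement (lookup xs (opposite i))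
  entry i = trans (lookup-map i complement (reverse xs)) (cong complement (lookup-reverse xs i))

sortDesc-complement : ∀ (xs : Vec ℕ n) → sortDesc (map complement xs) ≡ map complement (reverse (sortDesc xs))
sortDesc-complement xs =
  descending-↭⇒≡ (sortDesc-descending (map complement xs))
                 (descending-reverse-complement (sortDesc-descending xs))
                 (↭-trans (sortDesc-↭ (map complement xs)) (↭-sym complemented))
  where
  complemented : map complement (reverse (sortDesc xs)) ↭ᵛ map complement xs
  complemented = subst₂ _↭_
    (sym (trans (toList-map complement (reverse (sortDesc xs))) (cong (List.map complement) (toList-reverse (sortDesc xs)))))
    (sym (toList-map complement xs))
    (map⁺ complement (↭-trans (↭-reverse (toList (sortDesc xs))) (sortDesc-↭ xs)))

-- Decimal values and digits

value-acc : ∀ a (xs : Vec ℕ n) → foldl (λ _ → ℕ) (λ acc d → acc * 10 + d) a xs ≡ a * 10 ^ n + value xs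
value-acc a []         = sym (trans (+-identityʳ _) (*-identityʳ a))
value-acc {suc n} a (x ∷ xs) = begin
  foldl _ _ (a * 10 + x) xs                  ≡⟨ value-acc (a * 10 + x) xs ⟩
  (a * 10 + x) * 10 ^ n + value xs           ≡⟨ shift a x (10 ^ n) (value xs) ⟩
  a * (10 * 10 ^ n) + (x * 10 ^ n + value xs) ≡⟨ cong (a * (10 * 10 ^ n) +_) (sym (value-acc x xs)) ⟩
  a * 10 ^ suc n + value (x ∷ xs)            ∎
  where
  shift : ∀ a x p v → (a * 10 + x) * p + v ≡ a * (10 * p) + (x * p + v)
  shift = solve-∀

value-∷ : ∀ x (xs : Vec ℕ n) → value (x ∷ xs) ≡ x * 10 ^ n + value xs
value-∷ = value-acc

value-∷ʳ : ∀ (xs : Vec ℕ n) x → value (xs ∷ʳ x) ≡ value xs * 10 + x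
value-∷ʳ xs x = foldl-∷ʳ (λ _ → ℕ) (λ acc d → acc * 10 + d) 0 x xs

value-++ : ∀ {m} (xs : Vec ℕ m) (ys : Vec ℕ n) → value (xs ++ ys) ≡ value xs * 10 ^ n + value ys
value-++             []       ys = refl
value-++ {n} {suc m} (x ∷ xs) ys = begin
  value (x ∷ (xs ++ ys))                                ≡⟨ value-∷ x (xs ++ ys) ⟩
  x * 10 ^ (m + n) + value (xs ++ ys)                   ≡⟨ cong₂ (λ p v → x * p + v) (^-distribˡ-+-* 10 m n) (value-++ xs ys) ⟩
  x * (10 ^ m * 10 ^ n) + (value xs * 10 ^ n + value ys) ≡⟨ shift x (10 ^ m) (10 ^ n) (value xs) (value ys) ⟩
  (x * 10 ^ m + value xs) * 10 ^ n + value ys           ≡⟨ cong (λ v → v * 10 ^ n + value ys) (sym (value-∷ x xs)) ⟩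
  value (x ∷ xs) * 10 ^ n + value ys                    ∎
  where
  shift : ∀ x p q a b → x * (p * q) + (a * q + b) ≡ (x * p + a) * q + b
  shift = solve-∀

value-zipWith-+ : ∀ (xs ys : Vec ℕ n) → value (zipWith _+_ xs ys) ≡ value xs + value ys
value-zipWith-+         []       []       = refl
value-zipWith-+ {suc n} (x ∷ xs) (y ∷ ys) = begin
  value ((x + y) ∷ zipWith _+_ xs ys)          ≡⟨ value-∷ (x + y) (zipWith _+_ xs ys) ⟩
  (x + y) * 10 ^ n + value (zipWith _+_ xs ys) ≡⟨ cong ((x + y) * 10 ^ n +_) (value-zipWith-+ xs ys) ⟩
  (x + y) * 10 ^ n + (value xs + value ys)     ≡⟨ regroup x y (10 ^ n) (value xs) (value ys) ⟩
  (x * 10 ^ n + value xs) + (y * 10 ^ n + value ys) ≡⟨ sym (cong₂ _+_ (value-∷ x xs) (value-∷ y ys)) ⟩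
  value (x ∷ xs) + value (y ∷ ys)              ∎
  where
  regroup : ∀ x y p a b → (x + y) * p + (a + b) ≡ (x * p + a) + (y * p + b)
  regroup = solve-∀

value-complement : ∀ {xs : Vec ℕ n} → All (_≤ 9) xs → suc (value (map complement xs) + value xs) ≡ 10 ^ n
value-complement                  []         = refl
value-complement {suc n} {x ∷ xs} (x≤9 ∷ ps) = begin
  suc (value (complement x ∷ map complement xs) + value (x ∷ xs))
    ≡⟨ cong suc (cong₂ _+_ (value-∷ (complement x) (map complement xs)) (value-∷ x xs)) ⟩
  suc ((complement x * 10 ^ n + value (map complement xs)) + (x * 10 ^ n + value xs))
    ≡⟨ regroup (complement x) x (10 ^ n) (value (map complement xs)) (value xs) ⟩
  (complement x + x) * 10 ^ n + suc (value (map complement xs) + value xs)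
    ≡⟨ cong₂ (λ d r → d * 10 ^ n + r) (m∸n+n≡m x≤9) (value-complement ps) ⟩
  9 * 10 ^ n + 10 ^ n
    ≡⟨ +-comm (9 * 10 ^ n) (10 ^ n) ⟩
  10 ^ suc n ∎
  where
  regroup : ∀ c x p u v → suc ((c * p + u) + (x * p + v)) ≡ (c + x) * p + suc (u + v)
  regroup = solve-∀

last-digit : ∀ v {d} → d ≤ 9 → (v * 10 + d) % 10 ≡ d × (v * 10 + d) / 10 ≡ v
last-digit v {d} d≤9 =
  trans (%-remove-+ˡ d (n∣m*n v)) (m<n⇒m%n≡m (s≤s d≤9)) ,
  (begin
    (v * 10 + d) / 10     ≡⟨ +-distrib-/-∣ˡ d (n∣m*n v) ⟩
    v * 10 / 10 + d / 10  ≡⟨ cong₂ _+_ (m*n/n≡m v 10) (m<n⇒m/n≡0 (s≤s d≤9)) ⟩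
    v + 0                 ≡⟨ +-identityʳ v ⟩
    v                     ∎)

toDigitsLE-value : ∀ {xs : Vec ℕ n} → All (_≤ 9) xs → map toℕ (toDigitsLE n (value (reverse xs))) ≡ xs
toDigitsLE-value                []                = refl
toDigitsLE-value {suc n} {x ∷ xs} (x≤9 ∷ ps) = cong₂ _∷_
  (trans (toℕ-fromℕ< (m%n<n N 10)) (trans (cong (_% 10) N≡) (proj₁ (last-digit v x≤9))))
  (trans (cong (λ m → map toℕ (toDigitsLE n m)) (trans (cong (_/ 10) N≡) (proj₂ (last-digit v x≤9))))
         (toDigitsLE-value ps))
  where
  v = value (reverse xs)
  N = value (reverse (x ∷ xs))
  N≡ : N ≡ v * 10 + x
  N≡ = trans (cong value (reverse-∷ x xs)) (value-∷ʳ (reverse xs) x)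

toDigits-value : ∀ {xs : Vec ℕ n} → All (_≤ 9) xs → map toℕ (toDigits n (value xs)) ≡ xs
toDigits-value {n} {xs} ps = begin
  map toℕ (reverse (toDigitsLE n (value xs)))                   ≡⟨ map-reverse toℕ (toDigitsLE n (value xs)) ⟩
  reverse (map toℕ (toDigitsLE n (value xs)))                   ≡⟨ cong (λ ys → reverse (map toℕ (toDigitsLE n (value ys)))) (sym (reverse-involutive xs)) ⟩
  reverse (map toℕ (toDigitsLE n (value (reverse (reverse xs))))) ≡⟨ cong reverse (toDigitsLE-value (All-reverse⁺ ps)) ⟩
  reverse (reverse xs)                                          ≡⟨ reverse-involutive xs ⟩
  xs                                                            ∎

-- By definition  K u = toDigits n (difference (Od u)),  as  Ou = reverse ∘ Od.
difference : Vec ℕ n → ℕ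
difference xs = value xs ∸ value (reverse xs)

Od-≤9 : ∀ (u : Number n) → All (_≤ 9) (Od u)
Od-≤9 u = sortDesc-All (All.map⁺ (All.universal (λ d → ≤-pred (toℕ<n d)) u))

difference-reverse-complement : ∀ {xs : Vec ℕ n} → All (_≤ 9) xs →
                                difference (map complement (reverse xs)) ≡ difference xs
difference-reverse-complement {xs = xs} ps = begin
  value (map complement (reverse xs)) ∸ value (reverse (map complement (reverse xs)))
    ≡⟨ cong (λ ys → value (map complement (reverse xs)) ∸ value ys) reverse-complement ⟩
  value (map complement (reverse xs)) ∸ value (map complement xs)
    ≡⟨ ∸-cancel (value (map complement (reverse xs))) (value (map complement xs)) (value xs) (value (reverse xs))
                (suc-injective (trans (value-complement (All-reverse⁺ ps)) (sym (value-complement ps)))) ⟩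
  value xs ∸ value (reverse xs) ∎
  where
  reverse-complement : reverse (map complement (reverse xs)) ≡ map complement xs
  reverse-complement = trans (sym (map-reverse complement (reverse xs))) (cong (map complement) (reverse-involutive xs))
  ∸-cancel : ∀ a b x y → a + y ≡ b + x → a ∸ b ≡ x ∸ y
  ∸-cancel a b x y eq = begin
    a ∸ b             ≡⟨ sym ([m+n]∸[m+o]≡n∸o y a b) ⟩
    (y + a) ∸ (y + b) ≡⟨ cong₂ _∸_ (trans (+-comm y a) eq) (+-comm y b) ⟩
    (b + x) ∸ (b + y) ≡⟨ [m+n]∸[m+o]≡n∸o b x y ⟩
    x ∸ y             ∎

K-complement : ∀ (u v : Number n) → Od v ≡ map complement (reverse (Od u)) → K v ≡ K u
K-complement {n} u v eq = cong (toDigits n) (trans (cong difference eq) (difference-reverse-complement (Od-≤9 u)))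

-- Parameters

-- By definition  params h u = gaps h (Od u).
gaps : ∀ h → Vec ℕ (h + h) → Vec ℕ h
gaps h xs = tabulate λ i → lookup xs (i ↑ˡ h) ∸ lookup xs (opposite (i ↑ˡ h))

opposite-↑ˡ : ∀ h (i : Fin h) → opposite (i ↑ˡ h) ≡ h ↑ʳ opposite i
opposite-↑ˡ h i = toℕ-injective (begin
  toℕ (opposite (i ↑ˡ h))   ≡⟨ opposite-prop (i ↑ˡ h) ⟩
  (h + h) ∸ suc (toℕ (i ↑ˡ h)) ≡⟨ cong (λ t → (h + h) ∸ suc t) (toℕ-↑ˡ i h) ⟩
  (h + h) ∸ suc (toℕ i)     ≡⟨ +-∸-assoc h (toℕ<n i) ⟩
  h + (h ∸ suc (toℕ i))     ≡⟨ cong (h +_) (sym (opposite-prop i)) ⟩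
  h + toℕ (opposite i)      ≡⟨ sym (toℕ-↑ʳ h (opposite i)) ⟩
  toℕ (h ↑ʳ opposite i)     ∎)

lookup-++-opposite-↑ˡ : ∀ {h} (L R : Vec ℕ h) i → lookup (L ++ R) (opposite (i ↑ˡ h)) ≡ lookup (reverse R) i
lookup-++-opposite-↑ˡ {h} L R i = begin
  lookup (L ++ R) (opposite (i ↑ˡ h)) ≡⟨ cong (lookup (L ++ R)) (opposite-↑ˡ h i) ⟩
  lookup (L ++ R) (h ↑ʳ opposite i)   ≡⟨ lookup-++ʳ L R (opposite i) ⟩
  lookup R (opposite i)               ≡⟨ sym (lookup-reverse R i) ⟩
  lookup (reverse R) i                ∎

gaps-++ : ∀ {h} (L R : Vec ℕ h) → gaps h (L ++ R) ≡ zipWith _∸_ L (reverse R)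
gaps-++ {h} L R = Pointwise-≡⇒≡ (ext λ i → begin
  lookup (gaps h (L ++ R)) i                                    ≡⟨ lookup∘tabulate _ i ⟩
  lookup (L ++ R) (i ↑ˡ h) ∸ lookup (L ++ R) (opposite (i ↑ˡ h)) ≡⟨ cong₂ _∸_ (lookup-++ˡ L R i) (lookup-++-opposite-↑ˡ L R i) ⟩
  lookup L i ∸ lookup (reverse R) i                             ≡⟨ sym (lookup-zipWith _∸_ i L (reverse R)) ⟩
  lookup (zipWith _∸_ L (reverse R)) i                          ∎)

descending-++ : ∀ {h} (L R : Vec ℕ h) → Descending (L ++ R) → ∀ i → lookup (reverse R) i ≤ lookup L i
descending-++ {h} L R desc i =
  subst₂ _≤_ (lookup-++-opposite-↑ˡ L R i) (lookup-++ˡ L R i)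
    (descending-lookup⁺ desc left<right)
  where
  left<right : toℕ (i ↑ˡ h) < toℕ (opposite (i ↑ˡ h))
  left<right = subst₂ _<_ (sym (toℕ-↑ˡ i h)) (sym (trans (cong toℕ (opposite-↑ˡ h i)) (toℕ-↑ʳ h (opposite i))))
                 (≤-trans (toℕ<n i) (m≤m+n h _))

difference-halves : ∀ {h} (α R : Vec ℕ h) → difference (zipWith _+_ α (reverse R) ++ R) ≡ value α * 10 ^ h ∸ value (reverse α)
difference-halves {h} α R = begin
  value (L ++ R) ∸ value (reverse (L ++ R))           ≡⟨ cong₂ _∸_ value-L++R value-reverse ⟩
  (T + value α * P) ∸ (T + value (reverse α))         ≡⟨ [m+n]∸[m+o]≡n∸o T _ _ ⟩
  value α * P ∸ value (reverse α)                     ∎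
  where
  P = 10 ^ h
  L = zipWith _+_ α (reverse R)
  T = value (reverse R) * P + value R
  value-L++R : value (L ++ R) ≡ T + value α * P
  value-L++R = begin
    value (L ++ R)                                  ≡⟨ value-++ L R ⟩
    value L * P + value R                           ≡⟨ cong (λ v → v * P + value R) (value-zipWith-+ α (reverse R)) ⟩
    (value α + value (reverse R)) * P + value R     ≡⟨ regroup (value α) (value (reverse R)) P (value R) ⟩
    T + value α * P                                 ∎
    where
    regroup : ∀ a r p s → (a + r) * p + s ≡ (r * p + s) + a * p
    regroup = solve-∀
  reverse-L : reverse L ≡ zipWith _+_ (reverse α) R
  reverse-L = trans (reverse-zipWith _+_ α (reverse R)) (cong (zipWith _+_ (reverse α)) (reverse-involutive R))
  value-reverse : value (reverse (L ++ R)) ≡ T + value (reverse α)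
  value-reverse = begin
    value (reverse (L ++ R))                            ≡⟨ cong value (trans (sym (cast-is-id refl (reverse (L ++ R)))) (reverse-++-eqFree L R)) ⟩
    value (reverse R ++ reverse L)                      ≡⟨ value-++ (reverse R) (reverse L) ⟩
    value (reverse R) * P + value (reverse L)           ≡⟨ cong (λ v → value (reverse R) * P + value v) reverse-L ⟩
    value (reverse R) * P + value (zipWith _+_ (reverse α) R) ≡⟨ cong (value (reverse R) * P +_) (value-zipWith-+ (reverse α) R) ⟩
    value (reverse R) * P + (value (reverse α) + value R) ≡⟨ regroup (value (reverse R) * P) (value (reverse α)) (value R) ⟩
    T + value (reverse α)                               ∎
    where
    regroup : ∀ x a s → x + (a + s) ≡ (x + s) + a
    regroup = solve-∀

difference-gaps : ∀ h (xs : Vec ℕ (h + h)) → Descending xs →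
                  difference xs ≡ value (gaps h xs) * 10 ^ h ∸ value (reverse (gaps h xs))
difference-gaps h xs desc with splitAt h xs
... | L , R , refl = trans (cong (λ M → difference (M ++ R)) L≡) (difference-halves (gaps h (L ++ R)) R)
  where
  L≡ : L ≡ zipWith _+_ (gaps h (L ++ R)) (reverse R)
  L≡ = Pointwise-≡⇒≡ (ext λ i → sym (begin
    lookup (zipWith _+_ (gaps h (L ++ R)) (reverse R)) i       ≡⟨ lookup-zipWith _+_ i (gaps h (L ++ R)) (reverse R) ⟩
    lookup (gaps h (L ++ R)) i + lookup (reverse R) i         ≡⟨ cong (λ g → lookup g i + lookup (reverse R) i) (gaps-++ L R) ⟩
    lookup (zipWith _∸_ L (reverse R)) i + lookup (reverse R) i ≡⟨ cong (_+ lookup (reverse R) i) (lookup-zipWith _∸_ i L (reverse R)) ⟩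
    lookup L i ∸ lookup (reverse R) i + lookup (reverse R) i  ≡⟨ m∸n+n≡m (descending-++ L R desc i) ⟩
    lookup L i                                                ∎))

gaps-≤9 : ∀ h {xs : Vec ℕ (h + h)} → All (_≤ 9) xs → All (_≤ 9) (gaps h xs)
gaps-≤9 h {xs} ps = All.lookup⁻ λ i → subst (_≤ 9) (sym (lookup∘tabulate _ i))
  (≤-trans (m∸n≤m (lookup xs (i ↑ˡ h)) (lookup xs (opposite (i ↑ˡ h)))) (All.lookup⁺ ps (i ↑ˡ h)))

params-bounds : ∀ (u : Number ((2 + k) + (2 + k))) a (mid : Vec ℕ k) b → params (2 + k) u ≡ a ∷ (mid ∷ʳ b) →
                a ≤ 9 × All (_≤ 9) mid × b ≤ 9
params-bounds {k} u a mid b eq with subst (All (_≤ 9)) eq (gaps-≤9 (2 + k) (Od-≤9 u))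
... | a≤9 ∷ ps with All-∷ʳ⁻ mid ps
...   | mid≤9 , b≤9 = a≤9 , mid≤9 , b≤9

-- Subtraction with a borrow

upperHalf : ℕ → Vec ℕ k → ℕ → Vec ℕ (2 + k)
upperHalf a mid b = a ∷ (mid ∷ʳ (b ∸ 1))

lowerHalf : ℕ → Vec ℕ k → ℕ → Vec ℕ (2 + k)
lowerHalf a mid b = map complement (b ∷ reverse mid) ∷ʳ (10 ∸ a)

borrowDigits : ℕ → Vec ℕ k → ℕ → Vec ℕ ((2 + k) + (2 + k))
borrowDigits a mid b = upperHalf a mid b ++ lowerHalf a mid b

value-∷ʳ-suc : ∀ (xs : Vec ℕ n) d → value (xs ∷ʳ suc d) ≡ suc (value (xs ∷ʳ d))
value-∷ʳ-suc xs d = begin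
  value (xs ∷ʳ suc d)       ≡⟨ value-∷ʳ xs (suc d) ⟩
  value xs * 10 + suc d     ≡⟨ +-suc (value xs * 10) d ⟩
  suc (value xs * 10 + d)   ≡⟨ cong suc (sym (value-∷ʳ xs d)) ⟩
  suc (value (xs ∷ʳ d))     ∎

value-tensComplement : ∀ (xs : Vec ℕ n) x → All (_≤ 9) xs → x ≤ 10 →
                       value (map complement xs ∷ʳ (10 ∸ x)) + value (xs ∷ʳ x) ≡ 10 ^ suc n
value-tensComplement {n} xs x ps x≤10 = begin
  value (map complement xs ∷ʳ (10 ∸ x)) + value (xs ∷ʳ x)
    ≡⟨ cong₂ _+_ (value-∷ʳ (map complement xs) (10 ∸ x)) (value-∷ʳ xs x) ⟩
  (C * 10 + (10 ∸ x)) + (V * 10 + x) ≡⟨ regroup C V (10 ∸ x) x ⟩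
  (C + V) * 10 + ((10 ∸ x) + x)      ≡⟨ cong ((C + V) * 10 +_) (m∸n+n≡m x≤10) ⟩
  (C + V) * 10 + 10                  ≡⟨ carry (C + V) ⟩
  10 * suc (C + V)                   ≡⟨ cong (10 *_) (value-complement ps) ⟩
  10 ^ suc n                         ∎
  where
  C = value (map complement xs)
  V = value xs
  regroup : ∀ c v y x → (c * 10 + y) + (v * 10 + x) ≡ (c + v) * 10 + (y + x)
  regroup = solve-∀
  carry : ∀ s → s * 10 + 10 ≡ 10 * suc s
  carry = solve-∀

borrowDigits-value : ∀ a (mid : Vec ℕ k) b → 1 ≤ b → b ≤ 9 → a ≤ 10 → All (_≤ 9) mid →
                     value (a ∷ (mid ∷ʳ b)) * 10 ^ (2 + k) ∸ value (reverse (a ∷ (mid ∷ʳ b))) ≡ value (borrowDigits a mid b)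
borrowDigits-value {k} a mid (suc b) (s≤s z≤n) b<9 a≤10 mid≤9 = begin
  value ((a ∷ mid) ∷ʳ suc b) * P ∸ value (reverse (a ∷ (mid ∷ʳ suc b)))
    ≡⟨ cong₂ (λ x y → x * P ∸ y) (value-∷ʳ-suc (a ∷ mid) b) (cong value (reverse-∷-∷ʳ a mid (suc b))) ⟩
  suc (value (upperHalf a mid (suc b))) * P ∸ value ((suc b ∷ reverse mid) ∷ʳ a)
    ≡⟨ borrow (value (upperHalf a mid (suc b))) (value-tensComplement (suc b ∷ reverse mid) a (b<9 ∷ All-reverse⁺ mid≤9) a≤10) ⟩
  value (upperHalf a mid (suc b)) * P + value (lowerHalf a mid (suc b))
    ≡⟨ sym (value-++ (upperHalf a mid (suc b)) (lowerHalf a mid (suc b))) ⟩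
  value (borrowDigits a mid (suc b)) ∎
  where
  P = 10 ^ (2 + k)
  borrow : ∀ u {y z} → z + y ≡ P → suc u * P ∸ y ≡ u * P + z
  borrow u {y} {z} z+y≡P = begin
    suc u * P ∸ y       ≡⟨ cong (_∸ y) (+-comm P (u * P)) ⟩
    u * P + P ∸ y       ≡⟨ cong (λ p → u * P + p ∸ y) (sym z+y≡P) ⟩
    u * P + (z + y) ∸ y ≡⟨ cong (_∸ y) (sym (+-assoc (u * P) z y)) ⟩
    u * P + z + y ∸ y   ≡⟨ m+n∸n≡m (u * P + z) y ⟩
    u * P + z           ∎

borrowDigits-≤9 : ∀ a (mid : Vec ℕ k) b → 1 ≤ a → a ≤ 9 → b ≤ 10 → All (_≤ 9) mid → All (_≤ 9) (borrowDigits a mid b)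
borrowDigits-≤9 a mid b 1≤a a≤9 b≤10 mid≤9 = All.++⁺
  (a≤9 ∷ All-∷ʳ⁺ mid≤9 (∸-monoˡ-≤ 1 b≤10))
  (All-∷ʳ⁺ (map-complement-≤9 (b ∷ reverse mid)) (∸-monoʳ-≤ 10 1≤a))

upperHalf-dual : ∀ a (mid : Vec ℕ k) b → 1 ≤ b →
                 upperHalf (10 ∸ b) (map complement (reverse mid)) (10 ∸ a) ≡ reverse (map complement (upperHalf a mid b))
upperHalf-dual a mid (suc b) _ = begin
  (9 ∸ b) ∷ (map complement (reverse mid) ∷ʳ ((10 ∸ a) ∸ 1))
    ≡⟨ cong₂ (λ xs d → (9 ∸ b) ∷ (xs ∷ʳ d)) (map-reverse complement mid) 10∸a∸1 ⟩
  complement b ∷ (reverse (map complement mid) ∷ʳ complement a)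
    ≡⟨ sym (reverse-∷-∷ʳ (complement a) (map complement mid) (complement b)) ⟩
  reverse (complement a ∷ (map complement mid ∷ʳ complement b))
    ≡⟨ cong (λ xs → reverse (complement a ∷ xs)) (sym (map-∷ʳ complement b mid)) ⟩
  reverse (map complement (upperHalf a mid (suc b))) ∎
  where
  10∸a∸1 : (10 ∸ a) ∸ 1 ≡ complement a
  10∸a∸1 = trans (∸-+-assoc 10 a 1) (cong (10 ∸_) (+-comm a 1))

lowerHalf-dual : ∀ a (mid : Vec ℕ k) b → b ≤ 9 → All (_≤ 9) mid →
                 lowerHalf (10 ∸ b) (map complement (reverse mid)) (10 ∸ a) ≡ reverse (map complement (lowerHalf a mid b))
lowerHalf-dual a mid b b≤9 mid≤9 = begin
  complement (10 ∸ a) ∷ (map complement (reverse (map complement (reverse mid))) ∷ʳ (10 ∸ (10 ∸ b)))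
    ≡⟨ cong₂ (λ xs d → complement (10 ∸ a) ∷ (xs ∷ʳ d)) mid≡ (m∸[m∸n]≡n (≤-trans b≤9 (n≤1+n 9))) ⟩
  complement (10 ∸ a) ∷ (mid ∷ʳ b)
    ≡⟨ cong (λ xs → complement (10 ∸ a) ∷ (xs ∷ʳ b)) (sym (reverse-involutive mid)) ⟩
  complement (10 ∸ a) ∷ (reverse (reverse mid) ∷ʳ b)
    ≡⟨ sym (reverse-∷-∷ʳ b (reverse mid) (complement (10 ∸ a))) ⟩
  reverse ((b ∷ reverse mid) ∷ʳ complement (10 ∸ a))
    ≡⟨ cong (λ xs → reverse (xs ∷ʳ complement (10 ∸ a))) (sym (map-complement-involutive (b≤9 ∷ All-reverse⁺ mid≤9))) ⟩
  reverse (map complement (map complement (b ∷ reverse mid)) ∷ʳ complement (10 ∸ a))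
    ≡⟨ cong reverse (sym (map-∷ʳ complement (10 ∸ a) (map complement (b ∷ reverse mid)))) ⟩
  reverse (map complement (lowerHalf a mid b)) ∎
  where
  mid≡ : map complement (reverse (map complement (reverse mid))) ≡ mid
  mid≡ = begin
    map complement (reverse (map complement (reverse mid)))  ≡⟨ map-reverse complement (map complement (reverse mid)) ⟩
    reverse (map complement (map complement (reverse mid)))  ≡⟨ cong reverse (map-complement-involutive (All-reverse⁺ mid≤9)) ⟩
    reverse (reverse mid)                                    ≡⟨ reverse-involutive mid ⟩
    mid                                                      ∎

reverse-++-↭ : ∀ {m} (xs : Vec ℕ m) (ys : Vec ℕ n) → (reverse xs ++ reverse ys) ↭ᵛ (xs ++ ys)
reverse-++-↭ xs ys = subst₂ _↭_
  (sym (trans (toList-++ (reverse xs) (reverse ys)) (cong₂ List._++_ (toList-reverse xs) (toList-reverse ys))))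
  (sym (toList-++ xs ys))
  (++⁺ (↭-reverse (toList xs)) (↭-reverse (toList ys)))

borrowDigits-dual : ∀ a (mid : Vec ℕ k) b → 1 ≤ b → b ≤ 9 → All (_≤ 9) mid →
                    borrowDigits (10 ∸ b) (map complement (reverse mid)) (10 ∸ a) ↭ᵛ map complement (borrowDigits a mid b)
borrowDigits-dual a mid b 1≤b b≤9 mid≤9 = subst₂ _↭ᵛ_
  (sym (cong₂ _++_ (upperHalf-dual a mid b 1≤b) (lowerHalf-dual a mid b b≤9 mid≤9)))
  (sym (map-++ complement (upperHalf a mid b) (lowerHalf a mid b)))
  (reverse-++-↭ (map complement (upperHalf a mid b)) (map complement (lowerHalf a mid b)))

complParams-∷-∷ʳ : ∀ a (mid : Vec ℕ k) b →
                   complParams (a ∷ (mid ∷ʳ b)) ≡ (10 ∸ b) ∷ (map complement (reverse mid) ∷ʳ (10 ∸ a))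
complParams-∷-∷ʳ {k} a mid b = begin
  complParams α                                                      ≡⟨ tabulate-cong (λ i → cong (bound i ∸_) (sym (lookup-reverse α i))) ⟩
  tabulate (λ i → bound i ∸ lookup (reverse α) i)                    ≡⟨ cong (λ xs → tabulate (λ i → bound i ∸ lookup xs i)) (reverse-∷-∷ʳ a mid b) ⟩
  (10 ∸ b) ∷ tabulate (λ j → bound (suc j) ∸ lookup (reverse mid ∷ʳ a) j) ≡⟨ cong ((10 ∸ b) ∷_) (interior (reverse mid)) ⟩
  (10 ∸ b) ∷ (map complement (reverse mid) ∷ʳ (10 ∸ a))              ∎
  where
  α = a ∷ (mid ∷ʳ b)
  bound : Fin (2 + k) → ℕ
  bound i = if isEnd i then 10 else 9
  interior : ∀ {n} (xs : Vec ℕ n) →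
             tabulate (λ j → (if toℕ j ≡ᵇ n then 10 else 9) ∸ lookup (xs ∷ʳ a) j) ≡ map complement xs ∷ʳ (10 ∸ a)
  interior []       = refl
  interior (x ∷ xs) = cong (complement x ∷_) (interior xs)

K-borrowDigits : ∀ (u : Number ((2 + k) + (2 + k))) a (mid : Vec ℕ k) b → params (2 + k) u ≡ a ∷ (mid ∷ʳ b) →
                 1 ≤ a → 1 ≤ b → map toℕ (K u) ≡ borrowDigits a mid b
K-borrowDigits {k} u a mid b eq 1≤a 1≤b with params-bounds u a mid b eq
... | a≤9 , mid≤9 , b≤9 = begin
  map toℕ (toDigits h (difference (Od u)))
    ≡⟨ cong (λ d → map toℕ (toDigits h d)) (difference-gaps (2 + k) (Od u) (sortDesc-descending (map toℕ u))) ⟩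
  map toℕ (toDigits h (value (params (2 + k) u) * 10 ^ (2 + k) ∸ value (reverse (params (2 + k) u))))
    ≡⟨ cong (λ α → map toℕ (toDigits h (value α * 10 ^ (2 + k) ∸ value (reverse α)))) eq ⟩
  map toℕ (toDigits h (value (a ∷ (mid ∷ʳ b)) * 10 ^ (2 + k) ∸ value (reverse (a ∷ (mid ∷ʳ b)))))
    ≡⟨ cong (λ d → map toℕ (toDigits h d)) (borrowDigits-value a mid b 1≤b b≤9 (≤-trans a≤9 (n≤1+n 9)) mid≤9) ⟩
  map toℕ (toDigits h (value (borrowDigits a mid b)))
    ≡⟨ toDigits-value (borrowDigits-≤9 a mid b 1≤a a≤9 (≤-trans b≤9 (n≤1+n 9)) mid≤9) ⟩
  borrowDigits a mid b ∎
  where h = (2 + k) + (2 + k)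

m∸n<m⇒0<n : ∀ {m} n → m ∸ n < m → 0 < n
m∸n<m⇒0<n zero    m<m = ⊥-elim (<-irrefl refl m<m)
m∸n<m⇒0<n (suc n) _   = s≤s z≤n

Od-K-dual : ∀ (m n : Number ((2 + k) + (2 + k))) a (mid : Vec ℕ k) b →
            params (2 + k) m ≡ a ∷ (mid ∷ʳ b) →
            params (2 + k) n ≡ (10 ∸ b) ∷ (map complement (reverse mid) ∷ʳ (10 ∸ a)) →
            1 ≤ a → 1 ≤ b → Od (K n) ≡ map complement (reverse (Od (K m)))
Od-K-dual m n a mid b eqm eqn 1≤a 1≤b with params-bounds m a mid b eqm
... | a≤9 , mid≤9 , b≤9 = begin
  sortDesc (map toℕ (K n))
    ≡⟨ cong sortDesc (K-borrowDigits n (10 ∸ b) (map complement (reverse mid)) (10 ∸ a) eqn (∸-monoʳ-≤ 10 b≤9) (∸-monoʳ-≤ 10 a≤9)) ⟩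
  sortDesc (borrowDigits (10 ∸ b) (map complement (reverse mid)) (10 ∸ a))
    ≡⟨ sortDesc-cong-↭ (borrowDigits-dual a mid b 1≤b b≤9 mid≤9) ⟩
  sortDesc (map complement (borrowDigits a mid b))
    ≡⟨ sortDesc-complement (borrowDigits a mid b) ⟩
  map complement (reverse (sortDesc (borrowDigits a mid b)))
    ≡⟨ cong (λ xs → map complement (reverse (sortDesc xs))) (sym (K-borrowDigits m a mid b eqm 1≤a 1≤b)) ⟩
  map complement (reverse (Od (K m))) ∎

mainTheorem9 : (k : ℕ) → let h = 2 + k in
    (m n : Number (h + h)) → InA m → InA n →
    (α : Vec ℕ h) → params h m ≡ α →
    lookup α zero ≥ lookup α (suc zero) + 1 →
    params h n ≡ complParams α →
    K² m ≡ K² n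
mainTheorem9 k m n _ _ (a ∷ rest) eqm α¹>α² eqn with initLast rest
... | mid , b , refl = sym (K-complement (K m) (K n) (Od-K-dual m n a mid b eqm eqn′ 1≤a 1≤b))
  where
  eqn′ : params (2 + k) n ≡ (10 ∸ b) ∷ (map complement (reverse mid) ∷ʳ (10 ∸ a))
  eqn′ = trans eqn (complParams-∷-∷ʳ a mid b)
  1≤a : 1 ≤ a
  1≤a = ≤-trans (m≤n+m 1 _) α¹>α²
  1≤b : 1 ≤ b
  1≤b = m∸n<m⇒0<n b (s≤s (proj₁ (params-bounds n (10 ∸ b) (map complement (reverse mid)) (10 ∸ a) eqn′)))
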